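{- Let $G$ be any graph. Then: (i) there is a graph $H_1$ with $I(H_1;-1)=(-1)\cdot I(G;-1)$ and $\nu(H_1)=\nu(G)$; (ii) there is a graph $H_2$ with $I(H_2;-1)=I(G;-1)$ and $\nu(H_2)=\nu(G)+1$; (iii) for every positive integer $k$ there is a graph $H_3$ with $|I(H_3;-1)|=k\cdot|I(G;-1)|$ and $\nu(H_3)=\nu(G)+k-1$.
   Context: A stable set is a set of pairwise non-adjacent vertices; if $s_k$ is the number of stable sets of size $k$ (with $s_0=1$), $I(G;x)=\sum_ks_kx^k$ is the independence polynomial. The cyclomatic number is $\nu(G)=|E(G)|-|V(G)|+p$, with $p$ the number of connected components. -}

module Defs where

open import Data.Nat using (ℕ; zero; suc; _<ᵇ_)
open import Data.Bool using (Bool; true; false; _∧_; _∨_; not; if_then_else_)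
open import Data.Fin using (Fin; toℕ; _≟_)
open import Data.List using (List; []; _∷_; map; concatMap; filterᵇ; length; allFin; upTo; foldr; _++_)
open import Data.Bool.ListAction using (any; all)
open import Data.Vec using (Vec; []; _∷_; lookup)
open import Data.Integer using (ℤ; +_; -_; _+_; _-_; _*_)
open import Relation.Binary.PropositionalEquality using (_≡_)
open import Relation.Nullary.Decidable using (⌊_⌋)

record Graph : Set where
  field
    n      : ℕ
    adj    : Fin n → Fin n → Bool
    sym    : ∀ i j → adj i j ≡ adj j i
    irrefl : ∀ i → adj i i ≡ false
open Graph public

subsets : (m : ℕ) → List (Vec Bool m)
subsets zero = [] ∷ []
subsets (suc m) = map (false ∷_) (subsets m) ++ map (true ∷_) (subsets m)

size : ∀ {m} → Vec Bool m → ℕ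
size [] = 0
size (false ∷ xs) = size xs
size (true ∷ xs) = suc (size xs)

isStable : (G : Graph) → Vec Bool (n G) → Bool
isStable G S =
  all (λ i → all (λ j → not (lookup S i ∧ lookup S j ∧ adj G i j)) (allFin (n G))) (allFin (n G))

stableCount : Graph → ℕ → ℕ
stableCount G k = length (filterᵇ (λ S → isStable G S ∧ ⌊ size S Data.Nat.≟ k ⌋) (subsets (n G)))

negOnePow : ℕ → ℤ
negOnePow zero = + 1
negOnePow (suc k) = - negOnePow k

indepPolyAtNegOne : Graph → ℤ
indepPolyAtNegOne G = foldr (λ k acc → (+ stableCount G k) * negOnePow k + acc) (+ 0) (upTo (suc (n G)))

edgeCount : Graph → ℕ
edgeCount G =
  length (filterᵇ (λ ij → adj G (Data.Product.proj₁ ij) (Data.Product.proj₂ ij))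
    (concatMap (λ i → map (i Data.Product.,_) (filterᵇ (λ j → toℕ i <ᵇ toℕ j) (allFin (n G)))) (allFin (n G))))
  where import Data.Product

reach : (G : Graph) → ℕ → Fin (n G) → Fin (n G) → Bool
reach G zero u v = ⌊ u ≟ v ⌋
reach G (suc k) u v = reach G k u v ∨ any (λ w → adj G u w ∧ reach G k w v) (allFin (n G))

-- connected(G u v): u and v lie in the same component (a walk of length ≤ n suffices)
connected : (G : Graph) → Fin (n G) → Fin (n G) → Bool
connected G = reach G (n G)

-- p(G): number of connected components, counted via their least vertex
componentCount : Graph → ℕ
componentCount G =
  length (filterᵇ (λ v → not (any (λ u → (toℕ u <ᵇ toℕ v) ∧ connected G v u) (allFin (n G)))) (allFin (n G)))

cyclomatic : Graph → ℤ
cyclomatic G = (+ edgeCount G) - (+ n G) + (+ componentCount G)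

module Submission where

-- Deleting a vertex v splits the stable sets into those avoiding v and those containing it, so
-- I(G; −1) = I(G − v; −1) − I(G − N[v]; −1). Peeling off the vertices of G one at a time this way shows
-- I(G ⊔ H; −1) = I(G; −1) I(H; −1), while ν(G ⊔ H) = ν(G) + ν(H) since edges, vertices and components add up.
-- So it suffices to adjoin to G a graph H with the right pair (I(H; −1), ν(H)): K₂ has (−1, 0), C₅ has (1, 1),
-- and a row of k − 1 triangles, consecutive ones joined by an edge, has ((−1)^(k−1) k, k − 1), by induction
-- on the number of triangles, peeling off the first one vertex by vertex.

open import Defs
open import Data.Nat using (ℕ; suc; _≤_)
open import Data.Integer using (ℤ; +_; -_; _+_; _-_; ∣_∣)
open import Data.Product using (Σ; _×_)
open import Relation.Binary.PropositionalEquality using (_≡_)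

open import Data.Nat as ℕ using (zero; z≤n; s≤s; _<ᵇ_)
import Data.Nat.Properties as ℕ
import Data.Integer as ℤ
import Data.Integer.Properties as ℤ
open import Data.Integer.Tactic.RingSolver using (solve-∀)
open import Data.Nat.Tactic.RingSolver using () renaming (solve-∀ to ℕ-solve-∀)
open import Data.Bool using (Bool; true; false; _∧_; _∨_; not; _xor_; if_then_else_)
import Data.Bool.Properties as Bool
open import Algebra.Solver.IdempotentCommutativeMonoid Bool.∧-idempotentCommutativeMonoid
  using (solve; _⊜_) renaming (_⊕_ to _·_)
open import Data.Bool.ListAction using (any; all)
open import Data.Fin using (Fin; zero; suc; toℕ; _↑ˡ_; _↑ʳ_)
import Data.Fin as Fin
import Data.Fin.Properties as Fin
open import Data.List using (List; []; _∷_; _++_; _∷ʳ_; map; foldr; concatMap; filterᵇ; length; tabulate; upTo)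
import Data.List.Properties as List
open import Data.Vec using (Vec; []; _∷_; lookup)
open import Data.Product using (_,_; proj₁; proj₂)
open import Relation.Nullary using (¬_)
open import Function using (_∘_)
open import Data.Empty using (⊥-elim)
open import Relation.Nullary.Decidable using (⌊_⌋; yes; no; isYes≗does; dec-true; dec-false)
open import Relation.Binary.PropositionalEquality
  using (refl; trans; cong; cong₂; subst; _≗_; _≢_; module ≡-Reasoning)
import Relation.Binary.PropositionalEquality as ≡

open ≡-Reasoning

indicator : Bool → ℕ
indicator true  = 1
indicator false = 0

allᶠ : ∀ n → (Fin n → Bool) → Bool
allᶠ zero    p = true
allᶠ (suc n) p = p zero ∧ allᶠ n (p ∘ suc)

anyᶠ : ∀ n → (Fin n → Bool) → Bool
anyᶠ zero    p = false
anyᶠ (suc n) p = p zero ∨ anyᶠ n (p ∘ suc)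

sumᶠ : ∀ n → (Fin n → ℕ) → ℕ
sumᶠ zero    f = 0
sumᶠ (suc n) f = f zero ℕ.+ sumᶠ n (f ∘ suc)

countᶠ : ∀ n → (Fin n → Bool) → ℕ
countᶠ n p = sumᶠ n (indicator ∘ p)

all-tabulate : ∀ {A : Set} n (p : A → Bool) (f : Fin n → A) → all p (tabulate f) ≡ allᶠ n (p ∘ f)
all-tabulate zero    p f = refl
all-tabulate (suc n) p f = cong (p (f zero) ∧_) (all-tabulate n p (f ∘ suc))

any-tabulate : ∀ {A : Set} n (p : A → Bool) (f : Fin n → A) → any p (tabulate f) ≡ anyᶠ n (p ∘ f)
any-tabulate zero    p f = refl
any-tabulate (suc n) p f = cong (p (f zero) ∨_) (any-tabulate n p (f ∘ suc))

length-filterᵇ-∷ : ∀ {A : Set} (p : A → Bool) x xs →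
  length (filterᵇ p (x ∷ xs)) ≡ indicator (p x) ℕ.+ length (filterᵇ p xs)
length-filterᵇ-∷ p x xs with p x
... | true  = refl
... | false = refl

length-filterᵇ-tabulate : ∀ {A : Set} n (p : A → Bool) (f : Fin n → A) →
  length (filterᵇ p (tabulate f)) ≡ countᶠ n (p ∘ f)
length-filterᵇ-tabulate zero    p f = refl
length-filterᵇ-tabulate (suc n) p f =
  trans (length-filterᵇ-∷ p (f zero) _)
        (cong (indicator (p (f zero)) ℕ.+_) (length-filterᵇ-tabulate n p (f ∘ suc)))

allᶠ-cong : ∀ n {p q : Fin n → Bool} → p ≗ q → allᶠ n p ≡ allᶠ n q
allᶠ-cong zero    e = refl
allᶠ-cong (suc n) e = cong₂ _∧_ (e zero) (allᶠ-cong n (e ∘ suc))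

anyᶠ-cong : ∀ n {p q : Fin n → Bool} → p ≗ q → anyᶠ n p ≡ anyᶠ n q
anyᶠ-cong zero    e = refl
anyᶠ-cong (suc n) e = cong₂ _∨_ (e zero) (anyᶠ-cong n (e ∘ suc))

sumᶠ-cong : ∀ n {f g : Fin n → ℕ} → f ≗ g → sumᶠ n f ≡ sumᶠ n g
sumᶠ-cong zero    e = refl
sumᶠ-cong (suc n) e = cong₂ ℕ._+_ (e zero) (sumᶠ-cong n (e ∘ suc))

countᶠ-cong : ∀ n {p q : Fin n → Bool} → p ≗ q → countᶠ n p ≡ countᶠ n q
countᶠ-cong n e = sumᶠ-cong n (cong indicator ∘ e)

allᶠ-true : ∀ n → allᶠ n (λ _ → true) ≡ true
allᶠ-true zero    = refl
allᶠ-true (suc n) = allᶠ-true n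

anyᶠ-false : ∀ n {p : Fin n → Bool} → (∀ i → p i ≡ false) → anyᶠ n p ≡ false
anyᶠ-false zero    e = refl
anyᶠ-false (suc n) e = cong₂ _∨_ (e zero) (anyᶠ-false n (e ∘ suc))

countᶠ-false : ∀ n {p : Fin n → Bool} → (∀ i → p i ≡ false) → countᶠ n p ≡ 0
countᶠ-false zero    e = refl
countᶠ-false (suc n) e = cong₂ ℕ._+_ (cong indicator (e zero)) (countᶠ-false n (e ∘ suc))

allᶠ-∧ : ∀ n (p q : Fin n → Bool) → allᶠ n (λ i → p i ∧ q i) ≡ allᶠ n p ∧ allᶠ n q
allᶠ-∧ zero    p q = refl
allᶠ-∧ (suc n) p q with p zero | q zero
... | true  | true  = allᶠ-∧ n (p ∘ suc) (q ∘ suc)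
... | true  | false = ≡.sym (Bool.∧-zeroʳ _)
... | false | _     = refl

allᶠ-sound : ∀ n (p : Fin n → Bool) → allᶠ n p ≡ true → ∀ i → p i ≡ true
allᶠ-sound (suc n) p e i with p zero in p₀
allᶠ-sound (suc n) p e zero    | true = p₀
allᶠ-sound (suc n) p e (suc i) | true = allᶠ-sound n (p ∘ suc) e i

anyᶠ-complete : ∀ n (p : Fin n → Bool) i → p i ≡ true → anyᶠ n p ≡ true
anyᶠ-complete (suc n) p zero    e rewrite e = refl
anyᶠ-complete (suc n) p (suc i) e =
  trans (cong (p zero ∨_) (anyᶠ-complete n (p ∘ suc) i e)) (Bool.∨-zeroʳ _)

anyᶠ-+ : ∀ a {b} (p : Fin (a ℕ.+ b) → Bool) →
  anyᶠ (a ℕ.+ b) p ≡ anyᶠ a (λ i → p (i ↑ˡ b)) ∨ anyᶠ b (λ j → p (a ↑ʳ j))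
anyᶠ-+ zero    p = refl
anyᶠ-+ (suc a) p = trans (cong (p zero ∨_) (anyᶠ-+ a (p ∘ suc))) (≡.sym (Bool.∨-assoc (p zero) _ _))

anyᶠ-+-left : ∀ a {b} {p : Fin (a ℕ.+ b) → Bool} → (∀ j → p (a ↑ʳ j) ≡ false) →
  anyᶠ (a ℕ.+ b) p ≡ anyᶠ a (λ i → p (i ↑ˡ b))
anyᶠ-+-left a {b} {p} right-false =
  trans (anyᶠ-+ a p)
        (trans (cong (anyᶠ a (λ i → p (i ↑ˡ b)) ∨_) (anyᶠ-false b right-false)) (Bool.∨-identityʳ _))

anyᶠ-+-right : ∀ a {b} {p : Fin (a ℕ.+ b) → Bool} → (∀ i → p (i ↑ˡ b) ≡ false) →
  anyᶠ (a ℕ.+ b) p ≡ anyᶠ b (λ j → p (a ↑ʳ j))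
anyᶠ-+-right a {b} {p} left-false =
  trans (anyᶠ-+ a p) (cong (_∨ anyᶠ b (λ j → p (a ↑ʳ j))) (anyᶠ-false a left-false))

sumᶠ-+ : ∀ a {b} (f : Fin (a ℕ.+ b) → ℕ) →
  sumᶠ (a ℕ.+ b) f ≡ sumᶠ a (λ i → f (i ↑ˡ b)) ℕ.+ sumᶠ b (λ j → f (a ↑ʳ j))
sumᶠ-+ zero    f = refl
sumᶠ-+ (suc a) f = trans (cong (f zero ℕ.+_) (sumᶠ-+ a (f ∘ suc))) (≡.sym (ℕ.+-assoc (f zero) _ _))

countᶠ-≤ : ∀ n p → countᶠ n p ≤ n
countᶠ-≤ zero    p = z≤n
countᶠ-≤ (suc n) p with p zero
... | true  = s≤s (countᶠ-≤ n (p ∘ suc))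
... | false = ℕ.m≤n⇒m≤1+n (countᶠ-≤ n (p ∘ suc))

_⊆ᵇ_ : ∀ {n} → (Fin n → Bool) → (Fin n → Bool) → Set
p ⊆ᵇ q = ∀ i → p i ≡ true → q i ≡ true

countᶠ-mono : ∀ n {p q : Fin n → Bool} → p ⊆ᵇ q → countᶠ n p ≤ countᶠ n q
countᶠ-mono zero    p⊆q = z≤n
countᶠ-mono (suc n) {p} {q} p⊆q with p zero in p₀ | q zero in q₀
... | true  | true  = s≤s (countᶠ-mono n (p⊆q ∘ suc))
... | false | true  = ℕ.m≤n⇒m≤1+n (countᶠ-mono n (p⊆q ∘ suc))
... | false | false = countᶠ-mono n (p⊆q ∘ suc)
... | true  | false with () ← trans (≡.sym (p⊆q zero p₀)) q₀

countᶠ-⊆-≡ : ∀ n {p q : Fin n → Bool} → p ⊆ᵇ q → countᶠ n p ≡ countᶠ n q → p ≗ q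
countᶠ-⊆-≡ (suc n) {p} {q} p⊆q eq = pointwise
  where
  split : countᶠ (suc n) p ≡ countᶠ (suc n) q → p zero ≡ q zero × countᶠ n (p ∘ suc) ≡ countᶠ n (q ∘ suc)
  split eq with p zero in p₀ | q zero in q₀
  ... | true  | true  = refl , ℕ.suc-injective eq
  ... | false | false = refl , eq
  ... | true  | false with () ← trans (≡.sym (p⊆q zero p₀)) q₀
  ... | false | true  = ⊥-elim (ℕ.<-irrefl eq (s≤s (countᶠ-mono n (p⊆q ∘ suc))))
  pointwise : p ≗ q
  pointwise zero    = proj₁ (split eq)
  pointwise (suc i) = countᶠ-⊆-≡ n (p⊆q ∘ suc) (proj₂ (split eq)) i

countᶠ-< : ∀ n {p q : Fin n → Bool} → p ⊆ᵇ q → ¬ (p ≗ q) → countᶠ n p ℕ.< countᶠ n q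
countᶠ-< n p⊆q p≉q = ℕ.≤∧≢⇒< (countᶠ-mono n p⊆q) (p≉q ∘ countᶠ-⊆-≡ n p⊆q)

-- Signed counts of stable sets

Adjacency : ℕ → Set
Adjacency n = Fin n → Fin n → Bool

IsSymmetric : ∀ {n} → Adjacency n → Set
IsSymmetric a = ∀ i j → a i j ≡ a j i

IsIrreflexive : ∀ {n} → Adjacency n → Set
IsIrreflexive a = ∀ i → a i i ≡ false

tail : ∀ {n} → Adjacency (suc n) → Adjacency n
tail a i j = a (suc i) (suc j)

tail-sym : ∀ {n} {a : Adjacency (suc n)} → IsSymmetric a → IsSymmetric (tail a)
tail-sym a-sym i j = a-sym (suc i) (suc j)

tail-irrefl : ∀ {n} {a : Adjacency (suc n)} → IsIrreflexive a → IsIrreflexive (tail a)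
tail-irrefl a-irr = a-irr ∘ suc

weight : ∀ {m} → (Vec Bool m → Bool) → Vec Bool m → ℤ
weight p S = if p S then negOnePow (size S) else + 0

alternatingSum : ∀ {m} → (Vec Bool m → Bool) → List (Vec Bool m) → ℤ
alternatingSum p []       = + 0
alternatingSum p (S ∷ Ss) = weight p S + alternatingSum p Ss

signedCount : ∀ m → (Vec Bool m → Bool) → ℤ
signedCount m p = alternatingSum p (subsets m)

alternatingSum-cong : ∀ {m} {p q : Vec Bool m → Bool} → p ≗ q → ∀ Ss → alternatingSum p Ss ≡ alternatingSum q Ss
alternatingSum-cong e []       = refl
alternatingSum-cong e (S ∷ Ss) = cong₂ _+_ (cong (λ b → if b then _ else _) (e S)) (alternatingSum-cong e Ss)

signedCount-cong : ∀ m {p q : Vec Bool m → Bool} → p ≗ q → signedCount m p ≡ signedCount m q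
signedCount-cong m e = alternatingSum-cong e (subsets m)

signedCount-false : ∀ m → signedCount m (λ _ → false) ≡ + 0
signedCount-false m = go (subsets m)
  where
  go : ∀ Ss → alternatingSum (λ _ → false) Ss ≡ + 0
  go []       = refl
  go (S ∷ Ss) = trans (ℤ.+-identityˡ _) (go Ss)

alternatingSum-++ : ∀ {m} (p : Vec Bool m → Bool) Ss Ts →
  alternatingSum p (Ss ++ Ts) ≡ alternatingSum p Ss + alternatingSum p Ts
alternatingSum-++ p []       Ts = ≡.sym (ℤ.+-identityˡ _)
alternatingSum-++ p (S ∷ Ss) Ts =
  trans (cong (_+_ (weight p S)) (alternatingSum-++ p Ss Ts)) (≡.sym (ℤ.+-assoc (weight p S) _ _))

alternatingSum-false∷ : ∀ {m} (p : Vec Bool (suc m) → Bool) Ss →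
  alternatingSum p (map (false ∷_) Ss) ≡ alternatingSum (p ∘ (false ∷_)) Ss
alternatingSum-false∷ p []       = refl
alternatingSum-false∷ p (S ∷ Ss) = cong (_+_ (weight p (false ∷ S))) (alternatingSum-false∷ p Ss)

weight-true∷ : ∀ {m} (p : Vec Bool (suc m) → Bool) S → weight p (true ∷ S) ≡ - weight (p ∘ (true ∷_)) S
weight-true∷ p S with p (true ∷ S)
... | true  = refl
... | false = refl

alternatingSum-true∷ : ∀ {m} (p : Vec Bool (suc m) → Bool) Ss →
  alternatingSum p (map (true ∷_) Ss) ≡ - alternatingSum (p ∘ (true ∷_)) Ss
alternatingSum-true∷ p []       = refl
alternatingSum-true∷ p (S ∷ Ss) = begin
  weight p (true ∷ S) + alternatingSum p (map (true ∷_) Ss)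
    ≡⟨ cong₂ _+_ (weight-true∷ p S) (alternatingSum-true∷ p Ss) ⟩
  - weight (p ∘ (true ∷_)) S + - alternatingSum (p ∘ (true ∷_)) Ss
    ≡⟨ ≡.sym (ℤ.neg-distrib-+ (weight (p ∘ (true ∷_)) S) _) ⟩
  - alternatingSum (p ∘ (true ∷_)) (S ∷ Ss) ∎

signedCount-suc : ∀ m (p : Vec Bool (suc m) → Bool) →
  signedCount (suc m) p ≡ signedCount m (p ∘ (false ∷_)) - signedCount m (p ∘ (true ∷_))
signedCount-suc m p = trans (alternatingSum-++ p (map (false ∷_) (subsets m)) (map (true ∷_) (subsets m)))
  (cong₂ _+_ (alternatingSum-false∷ p (subsets m)) (alternatingSum-true∷ p (subsets m)))

none : ∀ {n} → Fin n → Bool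
none _ = false

Stable : ∀ {n} → Adjacency n → Vec Bool n → Bool
Stable {n} a S = allᶠ n λ i → allᶠ n λ j → not (lookup S i ∧ lookup S j ∧ a i j)

isStable≡Stable : ∀ G S → isStable G S ≡ Stable (adj G) S
isStable≡Stable G S =
  trans (all-tabulate (n G) _ (λ i → i)) (allᶠ-cong (n G) (λ i → all-tabulate (n G) _ (λ j → j)))

Avoids : ∀ {n} → (Fin n → Bool) → Vec Bool n → Bool
Avoids {n} X S = allᶠ n λ i → not (X i ∧ lookup S i)

-- I[ a ∖ X ] is I(G − X; −1), where G has adjacency a and X is a set of vertices.
I[_∖_] : ∀ {n} → Adjacency n → (Fin n → Bool) → ℤ
I[_∖_] {n} a X = signedCount n (λ S → Stable a S ∧ Avoids X S)

I[∖]-cong : ∀ {n} (a : Adjacency n) {X Y : Fin n → Bool} → X ≗ Y → I[ a ∖ X ] ≡ I[ a ∖ Y ]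
I[∖]-cong {n} a X≗Y =
  signedCount-cong n (λ S → cong (Stable a S ∧_)
    (allᶠ-cong n (λ i → cong (λ x → not (x ∧ lookup S i)) (X≗Y i))))

Stable-∷ : ∀ {n} {a : Adjacency (suc n)} → IsSymmetric a → IsIrreflexive a → ∀ b S →
  Stable a (b ∷ S) ≡ allᶠ n (λ j → not (b ∧ lookup S j ∧ a zero (suc j))) ∧ Stable (tail a) S
Stable-∷ {n} {a} a-sym a-irr b S = begin
  (not (b ∧ b ∧ a zero zero) ∧ E) ∧ allᶠ n (λ i → not (lookup S i ∧ b ∧ a (suc i) zero) ∧ Row i)
    ≡⟨ cong₂ (λ x y → (not (b ∧ b ∧ x) ∧ E) ∧ y) (a-irr zero) (allᶠ-∧ n _ Row) ⟩
  (not (b ∧ b ∧ false) ∧ E) ∧ (allᶠ n (λ i → not (lookup S i ∧ b ∧ a (suc i) zero)) ∧ Stable (tail a) S)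
    ≡⟨ cong₂ (λ x y → (not x ∧ E) ∧ (y ∧ Stable (tail a) S))
         (trans (cong (b ∧_) (Bool.∧-zeroʳ b)) (Bool.∧-zeroʳ b)) (allᶠ-cong n column≡row) ⟩
  E ∧ (E ∧ Stable (tail a) S)
    ≡⟨ solve 2 (λ e s → e · (e · s) ⊜ e · s) refl E _ ⟩
  E ∧ Stable (tail a) S ∎
  where
  E : Bool
  E = allᶠ n (λ j → not (b ∧ lookup S j ∧ a zero (suc j)))
  Row : Fin n → Bool
  Row i = allᶠ n (λ j → not (lookup S i ∧ lookup S j ∧ a (suc i) (suc j)))
  column≡row : ∀ i → not (lookup S i ∧ b ∧ a (suc i) zero) ≡ not (b ∧ lookup S i ∧ a zero (suc i))
  column≡row i = cong not (trans (cong (λ x → lookup S i ∧ b ∧ x) (a-sym (suc i) zero))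
    (solve 3 (λ s b x → s · (b · x) ⊜ b · (s · x)) refl (lookup S i) b _))

module _ {n} (a : Adjacency (suc n)) (a-sym : IsSymmetric a) (a-irr : IsIrreflexive a) (X : Fin (suc n) → Bool) where

  private
    N₀ : Fin n → Bool
    N₀ j = X (suc j) ∨ a zero (suc j)

  StableAvoids-false∷ : ∀ S →
    Stable a (false ∷ S) ∧ Avoids X (false ∷ S) ≡ Stable (tail a) S ∧ Avoids (X ∘ suc) S
  StableAvoids-false∷ S = cong₂ (λ s x → s ∧ (not x ∧ Avoids (X ∘ suc) S))
    (trans (Stable-∷ a-sym a-irr false S) (cong (_∧ Stable (tail a) S) (allᶠ-true n))) (Bool.∧-zeroʳ (X zero))

  StableAvoids-true∷ : ∀ S →
    Stable a (true ∷ S) ∧ Avoids X (true ∷ S) ≡ not (X zero) ∧ (Stable (tail a) S ∧ Avoids N₀ S)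
  StableAvoids-true∷ S = begin
    Stable a (true ∷ S) ∧ (not (X zero ∧ true) ∧ Avoids (X ∘ suc) S)
      ≡⟨ cong₂ (λ s x → s ∧ (not x ∧ Avoids (X ∘ suc) S))
           (Stable-∷ a-sym a-irr true S) (Bool.∧-identityʳ (X zero)) ⟩
    (E ∧ Stable (tail a) S) ∧ (not (X zero) ∧ Avoids (X ∘ suc) S)
      ≡⟨ solve 4 (λ e s x d → (e · s) · (x · d) ⊜ x · (s · (d · e))) refl
           E (Stable (tail a) S) (not (X zero)) (Avoids (X ∘ suc) S) ⟩
    not (X zero) ∧ (Stable (tail a) S ∧ (Avoids (X ∘ suc) S ∧ E))
      ≡⟨ cong (λ z → not (X zero) ∧ (Stable (tail a) S ∧ z))
           (≡.sym (trans (allᶠ-cong n (λ j → avoid-∨ (X (suc j)) (a zero (suc j)) (lookup S j)))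
                         (allᶠ-∧ n _ _))) ⟩
    not (X zero) ∧ (Stable (tail a) S ∧ Avoids N₀ S) ∎
    where
    E : Bool
    E = allᶠ n (λ j → not (lookup S j ∧ a zero (suc j)))
    avoid-∨ : ∀ x y s → not ((x ∨ y) ∧ s) ≡ not (x ∧ s) ∧ not (s ∧ y)
    avoid-∨ true  y     true  = refl
    avoid-∨ true  y     false = refl
    avoid-∨ false true  true  = refl
    avoid-∨ false true  false = refl
    avoid-∨ false false true  = refl
    avoid-∨ false false false = refl

  I-recurrence : I[ a ∖ X ] ≡ I[ tail a ∖ X ∘ suc ] - (if X zero then + 0 else I[ tail a ∖ N₀ ])
  I-recurrence = trans (signedCount-suc n _) (cong₂ _-_
    (signedCount-cong n StableAvoids-false∷)
    (trans (signedCount-cong n StableAvoids-true∷) (containing-zero (X zero))))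
    where
    containing-zero : ∀ b → signedCount n (λ S → not b ∧ (Stable (tail a) S ∧ Avoids N₀ S))
                          ≡ (if b then + 0 else I[ tail a ∖ N₀ ])
    containing-zero true  = signedCount-false n
    containing-zero false = refl

  I-recurrence-∈ : X zero ≡ true → I[ a ∖ X ] ≡ I[ tail a ∖ X ∘ suc ]
  I-recurrence-∈ 0∈X =
    trans I-recurrence (trans (cong (λ b → I[ tail a ∖ X ∘ suc ] - (if b then + 0 else I[ tail a ∖ N₀ ])) 0∈X)
                              (ℤ.+-identityʳ _))

  I-recurrence-∉ : X zero ≡ false → I[ a ∖ X ] ≡ I[ tail a ∖ X ∘ suc ] - I[ tail a ∖ N₀ ]
  I-recurrence-∉ 0∉X =
    trans I-recurrence (cong (λ b → I[ tail a ∖ X ∘ suc ] - (if b then + 0 else I[ tail a ∖ N₀ ])) 0∉X)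

size-≤ : ∀ {m} (S : Vec Bool m) → size S ≤ m
size-≤ []          = z≤n
size-≤ (false ∷ S) = ℕ.m≤n⇒m≤1+n (size-≤ S)
size-≤ (true ∷ S)  = s≤s (size-≤ S)

-- Σ_{k ∈ K} c k (−1)^k; indepPolyAtNegOne G is polySum (upTo (suc n)) (λ k → + s_k) by definition.
polySum : List ℕ → (ℕ → ℤ) → ℤ
polySum K c = foldr (λ k acc → c k ℤ.* negOnePow k + acc) (+ 0) K

polySum-cong : ∀ K {c d : ℕ → ℤ} → c ≗ d → polySum K c ≡ polySum K d
polySum-cong []      e = refl
polySum-cong (k ∷ K) e = cong₂ (λ x y → x ℤ.* negOnePow k + y) (e k) (polySum-cong K e)

polySum-zero : ∀ K {c : ℕ → ℤ} → (∀ k → c k ≡ + 0) → polySum K c ≡ + 0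
polySum-zero []      e = refl
polySum-zero (k ∷ K) e = cong₂ (λ x y → x ℤ.* negOnePow k + y) (e k) (polySum-zero K e)

polySum-+ : ∀ K (c d : ℕ → ℤ) → polySum K (λ k → c k + d k) ≡ polySum K c + polySum K d
polySum-+ []      c d = refl
polySum-+ (k ∷ K) c d = trans (cong (λ z → (c k + d k) ℤ.* negOnePow k + z) (polySum-+ K c d))
  (distrib (c k) (d k) (negOnePow k) (polySum K c) (polySum K d))
  where
  distrib : ∀ x y s u v → (x + y) ℤ.* s + (u + v) ≡ (x ℤ.* s + u) + (y ℤ.* s + v)
  distrib = solve-∀

polySum-∷ʳ : ∀ K k (c : ℕ → ℤ) → polySum (K ∷ʳ k) c ≡ polySum K c + c k ℤ.* negOnePow k
polySum-∷ʳ []      k c = trans (ℤ.+-identityʳ (c k ℤ.* negOnePow k)) (≡.sym (ℤ.+-identityˡ _))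
polySum-∷ʳ (j ∷ K) k c = trans (cong (λ z → c j ℤ.* negOnePow j + z) (polySum-∷ʳ K k c))
  (≡.sym (ℤ.+-assoc (c j ℤ.* negOnePow j) _ _))

polySum-upTo-suc : ∀ N (c : ℕ → ℤ) → polySum (upTo (suc N)) c ≡ polySum (upTo N) c + c N ℤ.* negOnePow N
polySum-upTo-suc N c = trans (cong (λ K → polySum K c) (≡.sym (List.upTo-∷ʳ N))) (polySum-∷ʳ (upTo N) N c)

δ : ℕ → ℕ → ℤ
δ s k = + indicator ⌊ s ℕ.≟ k ⌋

δ-≢ : ∀ {s k} → s ≢ k → δ s k ≡ + 0
δ-≢ {s} {k} s≢k with s ℕ.≟ k
... | yes s≡k = ⊥-elim (s≢k s≡k)
... | no  _   = refl

polySum-δ-below : ∀ s M → M ≤ s → polySum (upTo M) (δ s) ≡ + 0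
polySum-δ-below s zero    _   = refl
polySum-δ-below s (suc M) M<s = begin
  polySum (upTo (suc M)) (δ s)
    ≡⟨ polySum-upTo-suc M (δ s) ⟩
  polySum (upTo M) (δ s) + δ s M ℤ.* negOnePow M
    ≡⟨ cong₂ (λ x y → x + y ℤ.* negOnePow M) (polySum-δ-below s M (ℕ.<⇒≤ M<s)) (δ-≢ (ℕ.>⇒≢ M<s)) ⟩
  + 0 + + 0 ℤ.* negOnePow M
    ≡⟨ ℤ.*-zeroˡ (negOnePow M) ⟩
  + 0 ∎

polySum-δ : ∀ s N → s ≤ N → polySum (upTo (suc N)) (δ s) ≡ negOnePow s
polySum-δ s N s≤N with s ℕ.≟ N
... | yes refl = begin
  polySum (upTo (suc s)) (δ s)
    ≡⟨ polySum-upTo-suc s (δ s) ⟩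
  polySum (upTo s) (δ s) + δ s s ℤ.* negOnePow s
    ≡⟨ cong₂ (λ x y → x + y ℤ.* negOnePow s) (polySum-δ-below s s ℕ.≤-refl) δ-refl ⟩
  + 0 + + 1 ℤ.* negOnePow s
    ≡⟨ trans (ℤ.+-identityˡ _) (ℤ.*-identityˡ (negOnePow s)) ⟩
  negOnePow s ∎
  where
  δ-refl : δ s s ≡ + 1
  δ-refl with s ℕ.≟ s
  ... | yes _   = refl
  ... | no  s≢s = ⊥-elim (s≢s refl)
polySum-δ s zero    s≤N | no s≢0 = ⊥-elim (s≢0 (ℕ.n≤0⇒n≡0 s≤N))
polySum-δ s (suc N) s≤N | no s≢N = begin
  polySum (upTo (suc (suc N))) (δ s)
    ≡⟨ polySum-upTo-suc (suc N) (δ s) ⟩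
  polySum (upTo (suc N)) (δ s) + δ s (suc N) ℤ.* negOnePow (suc N)
    ≡⟨ cong₂ (λ x y → x + y ℤ.* negOnePow (suc N))
         (polySum-δ s N (ℕ.≤-pred (ℕ.≤∧≢⇒< s≤N s≢N))) (δ-≢ s≢N) ⟩
  negOnePow s + + 0 ℤ.* negOnePow (suc N)
    ≡⟨ ℤ.+-identityʳ (negOnePow s) ⟩
  negOnePow s ∎

-- Exchanging the order of summation: Σ_k (−1)^k #{S ∈ Ss | p S, |S| = k} = Σ_{S ∈ Ss, p S} (−1)^|S|.
polySum-count : ∀ {m} (p : Vec Bool m → Bool) Ss →
  polySum (upTo (suc m)) (λ k → + length (filterᵇ (λ S → p S ∧ ⌊ size S ℕ.≟ k ⌋) Ss)) ≡ alternatingSum p Ss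
polySum-count {m} p []       = polySum-zero (upTo (suc m)) (λ _ → refl)
polySum-count {m} p (S ∷ Ss) = begin
  polySum K (λ k → + length (filterᵇ (has k) (S ∷ Ss)))
    ≡⟨ polySum-cong K (λ k →
         trans (cong +_ (length-filterᵇ-∷ (has k) S Ss)) (ℤ.pos-+ (indicator (has k S)) _)) ⟩
  polySum K (λ k → + indicator (has k S) + + length (filterᵇ (has k) Ss))
    ≡⟨ polySum-+ K (λ k → + indicator (has k S)) (λ k → + length (filterᵇ (has k) Ss)) ⟩
  polySum K (λ k → + indicator (has k S)) + polySum K (λ k → + length (filterᵇ (has k) Ss))
    ≡⟨ cong₂ _+_ contribution (polySum-count p Ss) ⟩
  weight p S + alternatingSum p Ss ∎
  where
  K : List ℕ
  K = upTo (suc m)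
  has : ℕ → Vec Bool m → Bool
  has k S = p S ∧ ⌊ size S ℕ.≟ k ⌋
  contribution : polySum K (λ k → + indicator (has k S)) ≡ weight p S
  contribution with p S
  ... | true  = polySum-δ (size S) m (size-≤ S)
  ... | false = polySum-zero K (λ _ → refl)

indepPolyAtNegOne≡I : ∀ G → indepPolyAtNegOne G ≡ I[ adj G ∖ none ]
indepPolyAtNegOne≡I G = trans (polySum-count (isStable G) (subsets (n G)))
  (signedCount-cong (n G) (λ S → trans (isStable≡Stable G S)
    (≡.sym (trans (cong (Stable (adj G) S ∧_) (allᶠ-true (n G))) (Bool.∧-identityʳ _)))))

-- Disjoint unions

infixr 5 _⊕_

_⊕_ : ∀ {a b} → (Fin a → Bool) → (Fin b → Bool) → Fin (a ℕ.+ b) → Bool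
_⊕_ {zero}  X Y i       = Y i
_⊕_ {suc a} X Y zero    = X zero
_⊕_ {suc a} X Y (suc i) = (X ∘ suc ⊕ Y) i

⊕-cong : ∀ {a b} {X X′ : Fin a → Bool} {Y : Fin b → Bool} → X ≗ X′ → X ⊕ Y ≗ X′ ⊕ Y
⊕-cong {zero}  e i       = refl
⊕-cong {suc a} e zero    = e zero
⊕-cong {suc a} e (suc i) = ⊕-cong {a} (e ∘ suc) i

⊕-∨ : ∀ {a b} (X h : Fin a → Bool) (Y : Fin b → Bool) →
  (λ i → (X ⊕ Y) i ∨ (h ⊕ none) i) ≗ (λ t → X t ∨ h t) ⊕ Y
⊕-∨ {zero}  X h Y i       = Bool.∨-identityʳ (Y i)
⊕-∨ {suc a} X h Y zero    = refl
⊕-∨ {suc a} X h Y (suc i) = ⊕-∨ (X ∘ suc) (h ∘ suc) Y i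

none⊕none : ∀ {a b} → none {a} ⊕ none {b} ≗ none
none⊕none {zero}  i       = refl
none⊕none {suc a} zero    = refl
none⊕none {suc a} (suc i) = none⊕none {a} i

⊕-↑ˡ : ∀ {a b} (X : Fin a → Bool) (Y : Fin b → Bool) i → (X ⊕ Y) (i ↑ˡ b) ≡ X i
⊕-↑ˡ {suc a} X Y zero    = refl
⊕-↑ˡ {suc a} X Y (suc i) = ⊕-↑ˡ (X ∘ suc) Y i

⊕-↑ʳ : ∀ {a b} (X : Fin a → Bool) (Y : Fin b → Bool) j → (X ⊕ Y) (a ↑ʳ j) ≡ Y j
⊕-↑ʳ {zero}  X Y j = refl
⊕-↑ʳ {suc a} X Y j = ⊕-↑ʳ (X ∘ suc) Y j

infixr 5 _⊔ᵃ_

_⊔ᵃ_ : ∀ {a b} → Adjacency a → Adjacency b → Adjacency (a ℕ.+ b)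
_⊔ᵃ_ {zero}  g k i       j       = k i j
_⊔ᵃ_ {suc a} g k zero    zero    = g zero zero
_⊔ᵃ_ {suc a} g k zero    (suc j) = ((λ t → g zero (suc t)) ⊕ none) j
_⊔ᵃ_ {suc a} g k (suc i) zero    = ((λ t → g (suc t) zero) ⊕ none) i
_⊔ᵃ_ {suc a} g k (suc i) (suc j) = (tail g ⊔ᵃ k) i j

⊔ᵃ-sym : ∀ {a b} {g : Adjacency a} {k : Adjacency b} → IsSymmetric g → IsSymmetric k → IsSymmetric (g ⊔ᵃ k)
⊔ᵃ-sym {zero}  g-sym k-sym i       j       = k-sym i j
⊔ᵃ-sym {suc a} g-sym k-sym zero    zero    = refl
⊔ᵃ-sym {suc a} g-sym k-sym zero    (suc j) = ⊕-cong {a} (λ t → g-sym zero (suc t)) j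
⊔ᵃ-sym {suc a} g-sym k-sym (suc i) zero    = ⊕-cong {a} (λ t → g-sym (suc t) zero) i
⊔ᵃ-sym {suc a} g-sym k-sym (suc i) (suc j) = ⊔ᵃ-sym {a} (λ x y → g-sym (suc x) (suc y)) k-sym i j

⊔ᵃ-irrefl : ∀ {a b} {g : Adjacency a} {k : Adjacency b} →
  IsIrreflexive g → IsIrreflexive k → IsIrreflexive (g ⊔ᵃ k)
⊔ᵃ-irrefl {zero}  g-irr k-irr i       = k-irr i
⊔ᵃ-irrefl {suc a} g-irr k-irr zero    = g-irr zero
⊔ᵃ-irrefl {suc a} g-irr k-irr (suc i) = ⊔ᵃ-irrefl {a} (g-irr ∘ suc) k-irr i

⊔ᵃ-↑ˡ↑ˡ : ∀ {a b} (g : Adjacency a) (k : Adjacency b) i j → (g ⊔ᵃ k) (i ↑ˡ b) (j ↑ˡ b) ≡ g i j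
⊔ᵃ-↑ˡ↑ˡ {suc a} g k zero    zero    = refl
⊔ᵃ-↑ˡ↑ˡ {suc a} g k zero    (suc j) = ⊕-↑ˡ (λ t → g zero (suc t)) none j
⊔ᵃ-↑ˡ↑ˡ {suc a} g k (suc i) zero    = ⊕-↑ˡ (λ t → g (suc t) zero) none i
⊔ᵃ-↑ˡ↑ˡ {suc a} g k (suc i) (suc j) = ⊔ᵃ-↑ˡ↑ˡ (tail g) k i j

⊔ᵃ-↑ˡ↑ʳ : ∀ {a b} (g : Adjacency a) (k : Adjacency b) i j → (g ⊔ᵃ k) (i ↑ˡ b) (a ↑ʳ j) ≡ false
⊔ᵃ-↑ˡ↑ʳ {suc a} g k zero    j = ⊕-↑ʳ (λ t → g zero (suc t)) none j
⊔ᵃ-↑ˡ↑ʳ {suc a} g k (suc i) j = ⊔ᵃ-↑ˡ↑ʳ (tail g) k i j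

⊔ᵃ-↑ʳ↑ˡ : ∀ {a b} (g : Adjacency a) (k : Adjacency b) i j → (g ⊔ᵃ k) (a ↑ʳ i) (j ↑ˡ b) ≡ false
⊔ᵃ-↑ʳ↑ˡ {suc a} g k i zero    = ⊕-↑ʳ (λ t → g (suc t) zero) none i
⊔ᵃ-↑ʳ↑ˡ {suc a} g k i (suc j) = ⊔ᵃ-↑ʳ↑ˡ (tail g) k i j

⊔ᵃ-↑ʳ↑ʳ : ∀ {a b} (g : Adjacency a) (k : Adjacency b) i j → (g ⊔ᵃ k) (a ↑ʳ i) (a ↑ʳ j) ≡ k i j
⊔ᵃ-↑ʳ↑ʳ {zero}  g k i j = refl
⊔ᵃ-↑ʳ↑ʳ {suc a} g k i j = ⊔ᵃ-↑ʳ↑ʳ (tail g) k i j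

-- Expanding at vertex 0 on both sides: its neighbours all lie in g.
I-⊔ : ∀ {a b} {g : Adjacency a} {k : Adjacency b} →
  IsSymmetric g → IsIrreflexive g → IsSymmetric k → IsIrreflexive k →
  ∀ X Y → I[ g ⊔ᵃ k ∖ X ⊕ Y ] ≡ I[ g ∖ X ] ℤ.* I[ k ∖ Y ]
I-⊔ {zero}          g-sym g-irr k-sym k-irr X Y = ≡.sym (ℤ.*-identityˡ _)
I-⊔ {suc a} {b} {g} {k} g-sym g-irr k-sym k-irr X Y = begin
  I[ g ⊔ᵃ k ∖ X ⊕ Y ]
    ≡⟨ I-recurrence (g ⊔ᵃ k) (⊔ᵃ-sym g-sym k-sym) (⊔ᵃ-irrefl g-irr k-irr) (X ⊕ Y) ⟩
  I[ g′ ⊔ᵃ k ∖ X′ ⊕ Y ] - (if X zero then + 0 else I[ g′ ⊔ᵃ k ∖ (λ j → (X′ ⊕ Y) j ∨ (N₀ ⊕ none) j) ])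
    ≡⟨ cong₂ (λ u v → u - (if X zero then + 0 else v))
         (I-⊔ g′-sym g′-irr k-sym k-irr X′ Y)
         (trans (I[∖]-cong (g′ ⊔ᵃ k) (⊕-∨ X′ N₀ Y)) (I-⊔ g′-sym g′-irr k-sym k-irr (λ t → X′ t ∨ N₀ t) Y)) ⟩
  I[ g′ ∖ X′ ] ℤ.* I[ k ∖ Y ] - (if X zero then + 0 else I[ g′ ∖ (λ t → X′ t ∨ N₀ t) ] ℤ.* I[ k ∖ Y ])
    ≡⟨ factor (X zero) I[ g′ ∖ X′ ] I[ g′ ∖ (λ t → X′ t ∨ N₀ t) ] I[ k ∖ Y ] ⟩
  (I[ g′ ∖ X′ ] - (if X zero then + 0 else I[ g′ ∖ (λ t → X′ t ∨ N₀ t) ])) ℤ.* I[ k ∖ Y ]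
    ≡⟨ cong (ℤ._* I[ k ∖ Y ]) (≡.sym (I-recurrence g g-sym g-irr X)) ⟩
  I[ g ∖ X ] ℤ.* I[ k ∖ Y ] ∎
  where
  g′ : Adjacency a
  g′ = tail g
  X′ : Fin a → Bool
  X′ = X ∘ suc
  N₀ : Fin a → Bool
  N₀ t = g zero (suc t)
  g′-sym : IsSymmetric g′
  g′-sym = tail-sym {a = g} g-sym
  g′-irr : IsIrreflexive g′
  g′-irr = tail-irrefl {a = g} g-irr
  factor : ∀ c x y z → x ℤ.* z - (if c then + 0 else y ℤ.* z) ≡ (x - (if c then + 0 else y)) ℤ.* z
  factor true  x y z = trans (ℤ.+-identityʳ _) (cong (ℤ._* z) (≡.sym (ℤ.+-identityʳ x)))
  factor false x y z = distrib x y z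
    where
    distrib : ∀ x y z → x ℤ.* z - y ℤ.* z ≡ (x - y) ℤ.* z
    distrib = solve-∀

infixr 5 _⊔_

_⊔_ : Graph → Graph → Graph
G ⊔ K = record
  { n      = n G ℕ.+ n K
  ; adj    = adj G ⊔ᵃ adj K
  ; sym    = ⊔ᵃ-sym (Graph.sym G) (Graph.sym K)
  ; irrefl = ⊔ᵃ-irrefl (irrefl G) (irrefl K)
  }

indepPolyAtNegOne-⊔ : ∀ G K → indepPolyAtNegOne (G ⊔ K) ≡ indepPolyAtNegOne G ℤ.* indepPolyAtNegOne K
indepPolyAtNegOne-⊔ G K = begin
  indepPolyAtNegOne (G ⊔ K)
    ≡⟨ indepPolyAtNegOne≡I (G ⊔ K) ⟩
  I[ adj G ⊔ᵃ adj K ∖ none ]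
    ≡⟨ I[∖]-cong (adj G ⊔ᵃ adj K) (≡.sym ∘ none⊕none {n G} {n K}) ⟩
  I[ adj G ⊔ᵃ adj K ∖ none {n G} ⊕ none {n K} ]
    ≡⟨ I-⊔ (Graph.sym G) (irrefl G) (Graph.sym K) (irrefl K) none none ⟩
  I[ adj G ∖ none ] ℤ.* I[ adj K ∖ none ]
    ≡⟨ ≡.sym (cong₂ ℤ._*_ (indepPolyAtNegOne≡I G) (indepPolyAtNegOne≡I K)) ⟩
  indepPolyAtNegOne G ℤ.* indepPolyAtNegOne K ∎

-- Edges and components

edges : ∀ {n} → Adjacency n → ℕ
edges {n} a = sumᶠ n (λ i → countᶠ n (λ j → (toℕ i <ᵇ toℕ j) ∧ a i j))

length-filterᵇ-concatMap-tabulate : ∀ {A B : Set} m (q : B → Bool) (h : A → List B) (f : Fin m → A) →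
  length (filterᵇ q (concatMap h (tabulate f))) ≡ sumᶠ m (λ i → length (filterᵇ q (h (f i))))
length-filterᵇ-concatMap-tabulate zero    q h f = refl
length-filterᵇ-concatMap-tabulate (suc m) q h f = begin
  length (filterᵇ q (h (f zero) ++ concatMap h (tabulate (f ∘ suc))))
    ≡⟨ cong length (List.filter-++ _ (h (f zero)) (concatMap h (tabulate (f ∘ suc)))) ⟩
  length (filterᵇ q (h (f zero)) ++ filterᵇ q (concatMap h (tabulate (f ∘ suc))))
    ≡⟨ List.length-++ (filterᵇ q (h (f zero))) ⟩
  length (filterᵇ q (h (f zero))) ℕ.+ length (filterᵇ q (concatMap h (tabulate (f ∘ suc))))
    ≡⟨ cong (length (filterᵇ q (h (f zero))) ℕ.+_) (length-filterᵇ-concatMap-tabulate m q h (f ∘ suc)) ⟩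
  sumᶠ (suc m) (λ i → length (filterᵇ q (h (f i)))) ∎

length-filterᵇ-map-filterᵇ-tabulate : ∀ {A B : Set} m (q : B → Bool) (g : A → B) (r : A → Bool) (f : Fin m → A) →
  length (filterᵇ q (map g (filterᵇ r (tabulate f)))) ≡ countᶠ m (λ j → r (f j) ∧ q (g (f j)))
length-filterᵇ-map-filterᵇ-tabulate zero    q g r f = refl
length-filterᵇ-map-filterᵇ-tabulate (suc m) q g r f with r (f zero)
... | false = length-filterᵇ-map-filterᵇ-tabulate m q g r (f ∘ suc)
... | true  = trans (length-filterᵇ-∷ q (g (f zero)) _)
                    (cong (indicator (q (g (f zero))) ℕ.+_) (length-filterᵇ-map-filterᵇ-tabulate m q g r (f ∘ suc)))

edgeCount≡edges : ∀ G → edgeCount G ≡ edges (adj G)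
edgeCount≡edges G = trans (length-filterᵇ-concatMap-tabulate (n G) _ _ (λ i → i))
  (sumᶠ-cong (n G) (λ i → length-filterᵇ-map-filterᵇ-tabulate (n G) _ _ _ (λ j → j)))

countᶠ-⊕none : ∀ {a b} (h : Fin a → Bool) → countᶠ (a ℕ.+ b) (h ⊕ none) ≡ countᶠ a h
countᶠ-⊕none {zero}  {b} h = countᶠ-false b (λ _ → refl)
countᶠ-⊕none {suc a}     h = cong (indicator (h zero) ℕ.+_) (countᶠ-⊕none (h ∘ suc))

edges-⊔ : ∀ {a b} (g : Adjacency a) (k : Adjacency b) → edges (g ⊔ᵃ k) ≡ edges g ℕ.+ edges k
edges-⊔ {zero}      g k = refl
edges-⊔ {suc a} {b} g k = begin
  countᶠ (a ℕ.+ b) ((λ t → g zero (suc t)) ⊕ none) ℕ.+ edges (tail g ⊔ᵃ k)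
    ≡⟨ cong₂ ℕ._+_ (countᶠ-⊕none (λ t → g zero (suc t))) (edges-⊔ (tail g) k) ⟩
  countᶠ a (λ t → g zero (suc t)) ℕ.+ (edges (tail g) ℕ.+ edges k)
    ≡⟨ ≡.sym (ℕ.+-assoc (countᶠ a (λ t → g zero (suc t))) _ _) ⟩
  edges g ℕ.+ edges k ∎

reachable : ∀ {n} → Adjacency n → ℕ → Fin n → Fin n → Bool
reachable     a zero    u v = ⌊ u Fin.≟ v ⌋
reachable {n} a (suc k) u v = reachable a k u v ∨ anyᶠ n (λ w → a u w ∧ reachable a k w v)

reach≡reachable : ∀ G k u v → reach G k u v ≡ reachable (adj G) k u v
reach≡reachable G zero    u v = refl
reach≡reachable G (suc k) u v = cong₂ _∨_ (reach≡reachable G k u v)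
  (trans (any-tabulate (n G) _ (λ w → w))
         (anyᶠ-cong (n G) (λ w → cong (adj G u w ∧_) (reach≡reachable G k w v))))

reachable-mono : ∀ {n} (a : Adjacency n) d {k u v} → reachable a k u v ≡ true → reachable a (d ℕ.+ k) u v ≡ true
reachable-mono a zero    e = e
reachable-mono a (suc d) {k} {u} {v} e rewrite reachable-mono a d {k} {u} {v} e = refl

components : ∀ {n} → Adjacency n → ℕ
components {n} a = countᶠ n (λ v → not (anyᶠ n (λ u → (toℕ u <ᵇ toℕ v) ∧ reachable a n v u)))

componentCount≡components : ∀ G → componentCount G ≡ components (adj G)
componentCount≡components G =
  trans (length-filterᵇ-tabulate (n G) _ (λ v → v)) (countᶠ-cong (n G) (λ v → cong not
  (trans (any-tabulate (n G) _ (λ u → u))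
         (anyᶠ-cong (n G) (λ u → cong ((toℕ u <ᵇ toℕ v) ∧_) (reach≡reachable G (n G) v u))))))

module _ {n} (a : Adjacency n) (v : Fin n) where

  private
    R : ℕ → Fin n → Bool
    R k u = reachable a k u v

    R-⊆ : ∀ k → R k ⊆ᵇ R (suc k)
    R-⊆ k u e rewrite e = refl

    R-settles : ∀ k → R k ≗ R (suc k) → R (suc k) ≗ R (suc (suc k))
    R-settles k same u = ≡.sym (begin
      R (suc k) u ∨ anyᶠ n (λ w → a u w ∧ R (suc k) w)
        ≡⟨ cong (R (suc k) u ∨_) (anyᶠ-cong n (λ w → cong (a u w ∧_) (≡.sym (same w)))) ⟩
      (R k u ∨ N) ∨ N
        ≡⟨ Bool.∨-assoc (R k u) N N ⟩
      R k u ∨ (N ∨ N)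
        ≡⟨ cong (R k u ∨_) (Bool.∨-idem N) ⟩
      R (suc k) u ∎)
      where
      N : Bool
      N = anyᶠ n (λ w → a u w ∧ R k w)

    -- While the ball R k keeps growing it has more than k vertices, so it stops growing by radius n.
    R-grows : ∀ k → ¬ (R k ≗ R (suc k)) → suc k ≤ countᶠ n (R (suc k))
    R-grows zero    grows = ℕ.≤-trans (s≤s z≤n) (countᶠ-< n (R-⊆ zero) grows)
    R-grows (suc k) grows =
      ℕ.≤-trans (s≤s (R-grows k (grows ∘ R-settles k))) (countᶠ-< n (R-⊆ (suc k)) grows)

    R-settled : ∀ d → R (d ℕ.+ n) ≗ R (suc (d ℕ.+ n))
    R-settled zero    u with R n u Bool.≟ R (suc n) u
    ... | yes same = same
    ... | no  grows = ⊥-elim (ℕ.<-irrefl refl (ℕ.≤-trans (R-grows n (λ h → grows (h u))) (countᶠ-≤ n _)))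
    R-settled (suc d) = R-settles (d ℕ.+ n) (R-settled d)

    R-+ : ∀ d → R (d ℕ.+ n) ≗ R n
    R-+ zero    u = refl
    R-+ (suc d) u = trans (≡.sym (R-settled d u)) (R-+ d u)

  reachable-stable : ∀ {k} → n ≤ k → ∀ u → reachable a k u v ≡ reachable a n u v
  reachable-stable {k} n≤k u = trans (cong (λ m → R m u) (≡.sym (ℕ.m∸n+n≡m n≤k))) (R-+ (k ℕ.∸ n) u)

⌊≟⌋-injective : ∀ {m n} (f : Fin m → Fin n) → (∀ {x y} → f x ≡ f y → x ≡ y) →
  ∀ x y → ⌊ f x Fin.≟ f y ⌋ ≡ ⌊ x Fin.≟ y ⌋
⌊≟⌋-injective f f-inj x y with x Fin.≟ y
... | yes refl = trans (isYes≗does _) (dec-true (f x Fin.≟ f x) refl)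
... | no  x≢y  = trans (isYes≗does _) (dec-false (f x Fin.≟ f y) (x≢y ∘ f-inj))

↑ˡ≢↑ʳ : ∀ {a b} (i : Fin a) (j : Fin b) → i ↑ˡ b ≢ a ↑ʳ j
↑ˡ≢↑ʳ {a} {b} i j eq
  with () ← trans (≡.sym (Fin.splitAt-↑ˡ a i b)) (trans (cong (Fin.splitAt a) eq) (Fin.splitAt-↑ʳ a b j))

module _ {a b} (g : Adjacency a) (k : Adjacency b) where

  reachable-↑ˡ↑ˡ : ∀ m u v → reachable (g ⊔ᵃ k) m (u ↑ˡ b) (v ↑ˡ b) ≡ reachable g m u v
  reachable-↑ˡ↑ˡ zero    u v = ⌊≟⌋-injective (_↑ˡ b) (Fin.↑ˡ-injective b _ _) u v
  reachable-↑ˡ↑ˡ (suc m) u v = cong₂ _∨_ (reachable-↑ˡ↑ˡ m u v)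
    (trans (anyᶠ-+-left a (λ w → cong (_∧ _) (⊔ᵃ-↑ˡ↑ʳ g k u w)))
           (anyᶠ-cong a (λ w → cong₂ _∧_ (⊔ᵃ-↑ˡ↑ˡ g k u w) (reachable-↑ˡ↑ˡ m w v))))

  reachable-↑ʳ↑ʳ : ∀ m u v → reachable (g ⊔ᵃ k) m (a ↑ʳ u) (a ↑ʳ v) ≡ reachable k m u v
  reachable-↑ʳ↑ʳ zero    u v = ⌊≟⌋-injective (a ↑ʳ_) (Fin.↑ʳ-injective a _ _) u v
  reachable-↑ʳ↑ʳ (suc m) u v = cong₂ _∨_ (reachable-↑ʳ↑ʳ m u v)
    (trans (anyᶠ-+-right a (λ w → cong (_∧ _) (⊔ᵃ-↑ʳ↑ˡ g k u w)))
           (anyᶠ-cong b (λ w → cong₂ _∧_ (⊔ᵃ-↑ʳ↑ʳ g k u w) (reachable-↑ʳ↑ʳ m w v))))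

  reachable-↑ˡ↑ʳ : ∀ m u v → reachable (g ⊔ᵃ k) m (u ↑ˡ b) (a ↑ʳ v) ≡ false
  reachable-↑ˡ↑ʳ zero    u v = trans (isYes≗does _) (dec-false (u ↑ˡ b Fin.≟ a ↑ʳ v) (↑ˡ≢↑ʳ u v))
  reachable-↑ˡ↑ʳ (suc m) u v = cong₂ _∨_ (reachable-↑ˡ↑ʳ m u v)
    (trans (anyᶠ-+-left a (λ w → cong (_∧ _) (⊔ᵃ-↑ˡ↑ʳ g k u w)))
           (anyᶠ-false a (λ w → trans (cong (_ ∧_) (reachable-↑ˡ↑ʳ m w v)) (Bool.∧-zeroʳ _))))

  reachable-↑ʳ↑ˡ : ∀ m u v → reachable (g ⊔ᵃ k) m (a ↑ʳ u) (v ↑ˡ b) ≡ false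
  reachable-↑ʳ↑ˡ zero    u v = trans (isYes≗does _) (dec-false (a ↑ʳ u Fin.≟ v ↑ˡ b) (↑ˡ≢↑ʳ v u ∘ ≡.sym))
  reachable-↑ʳ↑ˡ (suc m) u v = cong₂ _∨_ (reachable-↑ʳ↑ˡ m u v)
    (trans (anyᶠ-+-right a (λ w → cong (_∧ _) (⊔ᵃ-↑ʳ↑ˡ g k u w)))
           (anyᶠ-false b (λ w → trans (cong (_ ∧_) (reachable-↑ʳ↑ˡ m w v)) (Bool.∧-zeroʳ _))))

<ᵇ-+-cancelˡ : ∀ a x y → ((a ℕ.+ x) <ᵇ (a ℕ.+ y)) ≡ (x <ᵇ y)
<ᵇ-+-cancelˡ zero    x y = refl
<ᵇ-+-cancelˡ (suc a) x y = <ᵇ-+-cancelˡ a x y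

components-⊔ : ∀ {a b} (g : Adjacency a) (k : Adjacency b) → components (g ⊔ᵃ k) ≡ components g ℕ.+ components k
components-⊔ {a} {b} g k = trans (sumᶠ-+ a _) (cong₂ ℕ._+_ (countᶠ-cong a left) (countᶠ-cong b right))
  where
  leader : ∀ {n} → Adjacency n → ℕ → Fin n → Bool
  leader {n} h r v = not (anyᶠ n (λ u → (toℕ u <ᵇ toℕ v) ∧ reachable h r v u))
  left : ∀ v → leader (g ⊔ᵃ k) (a ℕ.+ b) (v ↑ˡ b) ≡ leader g a v
  left v = cong not (trans
    (anyᶠ-+-left a (λ u → trans (cong (_ ∧_) (reachable-↑ˡ↑ʳ g k (a ℕ.+ b) v u)) (Bool.∧-zeroʳ _)))
    (anyᶠ-cong a (λ u → cong₂ _∧_ (cong₂ _<ᵇ_ (Fin.toℕ-↑ˡ u b) (Fin.toℕ-↑ˡ v b))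
      (trans (reachable-↑ˡ↑ˡ g k (a ℕ.+ b) v u) (reachable-stable g u (ℕ.m≤m+n a b) v)))))
  right : ∀ v → leader (g ⊔ᵃ k) (a ℕ.+ b) (a ↑ʳ v) ≡ leader k b v
  right v = cong not (trans
    (anyᶠ-+-right a (λ u → trans (cong (_ ∧_) (reachable-↑ʳ↑ˡ g k (a ℕ.+ b) v u)) (Bool.∧-zeroʳ _)))
    (anyᶠ-cong b (λ u → cong₂ _∧_
      (trans (cong₂ _<ᵇ_ (Fin.toℕ-↑ʳ a u) (Fin.toℕ-↑ʳ a v)) (<ᵇ-+-cancelˡ a (toℕ u) (toℕ v)))
      (trans (reachable-↑ʳ↑ʳ g k (a ℕ.+ b) v u) (reachable-stable k u (ℕ.m≤n+m b a) v)))))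

components-traceable : ∀ {N} (a : Adjacency (suc N)) → (∀ (w : Fin N) → a (suc w) (Fin.inject₁ w) ≡ true) →
  components a ≡ 1
components-traceable {N} a path = cong₂ ℕ._+_
  (cong (indicator ∘ not) (anyᶠ-false (suc N) (λ _ → refl)))
  (countᶠ-false N (λ v → cong (λ r → not (r ∨ later v)) (reaches-zero (suc v))))
  where
  later : Fin N → Bool
  later v = anyᶠ N (λ u → (toℕ (suc u) <ᵇ toℕ (suc v)) ∧ reachable a (suc N) (suc v) (suc u))
  walk : ∀ t (w : Fin (suc N)) → toℕ w ≡ t → reachable a t w zero ≡ true
  walk zero    zero    _  = refl
  walk (suc t) (suc w) eq = trans (cong (reachable a t (suc w) zero ∨_)
    (anyᶠ-complete (suc N) (λ x → a (suc w) x ∧ reachable a t x zero) (Fin.inject₁ w)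
      (cong₂ _∧_ (path w) (walk t (Fin.inject₁ w) (trans (Fin.toℕ-inject₁ w) (ℕ.suc-injective eq))))))
    (Bool.∨-zeroʳ _)
  reaches-zero : ∀ w → reachable a (suc N) w zero ≡ true
  reaches-zero w = subst (λ k → reachable a k w zero ≡ true) (ℕ.m∸n+n≡m (ℕ.<⇒≤ (Fin.toℕ<n w)))
    (reachable-mono a (suc N ℕ.∸ toℕ w) (walk (toℕ w) w refl))

cyclomaticNumber : ℕ → ℕ → ℕ → ℤ
cyclomaticNumber v e c = + e - + v + + c

cyclomaticNumber-+ : ∀ v₁ v₂ e₁ e₂ c₁ c₂ →
  cyclomaticNumber (v₁ ℕ.+ v₂) (e₁ ℕ.+ e₂) (c₁ ℕ.+ c₂) ≡ cyclomaticNumber v₁ e₁ c₁ + cyclomaticNumber v₂ e₂ c₂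
cyclomaticNumber-+ v₁ v₂ e₁ e₂ c₁ c₂ = begin
  + (e₁ ℕ.+ e₂) - + (v₁ ℕ.+ v₂) + + (c₁ ℕ.+ c₂)
    ≡⟨ cong₂ (λ e c → e - + (v₁ ℕ.+ v₂) + c) (ℤ.pos-+ e₁ e₂) (ℤ.pos-+ c₁ c₂) ⟩
  (+ e₁ + + e₂) - + (v₁ ℕ.+ v₂) + (+ c₁ + + c₂)
    ≡⟨ cong (λ v → (+ e₁ + + e₂) - v + (+ c₁ + + c₂)) (ℤ.pos-+ v₁ v₂) ⟩
  (+ e₁ + + e₂) - (+ v₁ + + v₂) + (+ c₁ + + c₂)
    ≡⟨ regroup (+ e₁) (+ e₂) (+ v₁) (+ v₂) (+ c₁) (+ c₂) ⟩
  cyclomaticNumber v₁ e₁ c₁ + cyclomaticNumber v₂ e₂ c₂ ∎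
  where
  regroup : ∀ e₁ e₂ v₁ v₂ c₁ c₂ → (e₁ + e₂) - (v₁ + v₂) + (c₁ + c₂) ≡ (e₁ - v₁ + c₁) + (e₂ - v₂ + c₂)
  regroup = solve-∀

cyclomatic≡cyclomaticNumber : ∀ G → cyclomatic G ≡ cyclomaticNumber (n G) (edges (adj G)) (components (adj G))
cyclomatic≡cyclomaticNumber G =
  cong₂ (λ e c → + e - + n G + + c) (edgeCount≡edges G) (componentCount≡components G)

cyclomatic-⊔ : ∀ G K → cyclomatic (G ⊔ K) ≡ cyclomatic G + cyclomatic K
cyclomatic-⊔ G K = begin
  cyclomatic (G ⊔ K)
    ≡⟨ cyclomatic≡cyclomaticNumber (G ⊔ K) ⟩
  cyclomaticNumber (n G ℕ.+ n K) (edges (adj G ⊔ᵃ adj K)) (components (adj G ⊔ᵃ adj K))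
    ≡⟨ cong₂ (cyclomaticNumber (n G ℕ.+ n K)) (edges-⊔ (adj G) (adj K)) (components-⊔ (adj G) (adj K)) ⟩
  cyclomaticNumber (n G ℕ.+ n K) (edges (adj G) ℕ.+ edges (adj K)) (components (adj G) ℕ.+ components (adj K))
    ≡⟨ cyclomaticNumber-+ (n G) (n K) _ _ _ _ ⟩
  cyclomaticNumber (n G) (edges (adj G)) (components (adj G)) + cyclomaticNumber (n K) (edges (adj K)) (components (adj K))
    ≡⟨ ≡.sym (cong₂ _+_ (cyclomatic≡cyclomaticNumber G) (cyclomatic≡cyclomaticNumber K)) ⟩
  cyclomatic G + cyclomatic K ∎

checkedGraph : ∀ m (a : Adjacency m) →
  allᶠ m (λ i → allᶠ m (λ j → not (a i j xor a j i))) ≡ true → allᶠ m (λ i → not (a i i)) ≡ true → Graph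
checkedGraph m a sym-ok irrefl-ok = record
  { n      = m
  ; adj    = a
  ; sym    = λ i j → xnor-true (allᶠ-sound m _ (allᶠ-sound m _ sym-ok i) j)
  ; irrefl = λ i → not-true (allᶠ-sound m _ irrefl-ok i)
  }
  where
  xnor-true : ∀ {x y} → not (x xor y) ≡ true → x ≡ y
  xnor-true {true}  {true}  _ = refl
  xnor-true {false} {false} _ = refl
  not-true : ∀ {x} → not x ≡ true → x ≡ false
  not-true {false} _ = refl

K₂ : Graph
K₂ = checkedGraph 2 (λ i j → not ⌊ i Fin.≟ j ⌋) refl refl

C₅ : Graph
C₅ = checkedGraph 5 (λ i j → (suc (toℕ i) ℕ.% 5 ℕ.≡ᵇ toℕ j) ∨ (suc (toℕ j) ℕ.% 5 ℕ.≡ᵇ toℕ i)) refl refl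

indepPolyAtNegOne-K₂ : indepPolyAtNegOne K₂ ≡ - + 1
indepPolyAtNegOne-K₂ = refl

cyclomatic-K₂ : cyclomatic K₂ ≡ + 0
cyclomatic-K₂ = refl

indepPolyAtNegOne-C₅ : indepPolyAtNegOne C₅ ≡ + 1
indepPolyAtNegOne-C₅ = refl

cyclomatic-C₅ : cyclomatic C₅ ≡ + 1
cyclomatic-C₅ = refl

indepPolyAtNegOne-⊔-K₂ : ∀ G → indepPolyAtNegOne (G ⊔ K₂) ≡ - indepPolyAtNegOne G
indepPolyAtNegOne-⊔-K₂ G = begin
  indepPolyAtNegOne (G ⊔ K₂)                 ≡⟨ indepPolyAtNegOne-⊔ G K₂ ⟩
  indepPolyAtNegOne G ℤ.* indepPolyAtNegOne K₂ ≡⟨ cong (indepPolyAtNegOne G ℤ.*_) indepPolyAtNegOne-K₂ ⟩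
  indepPolyAtNegOne G ℤ.* - + 1              ≡⟨ ℤ.*-comm (indepPolyAtNegOne G) (- + 1) ⟩
  - + 1 ℤ.* indepPolyAtNegOne G              ≡⟨ ℤ.-1*i≡-i (indepPolyAtNegOne G) ⟩
  - indepPolyAtNegOne G ∎

cyclomatic-⊔-K₂ : ∀ G → cyclomatic (G ⊔ K₂) ≡ cyclomatic G
cyclomatic-⊔-K₂ G = trans (cyclomatic-⊔ G K₂) (trans (cong (_+_ (cyclomatic G)) cyclomatic-K₂) (ℤ.+-identityʳ _))

indepPolyAtNegOne-⊔-C₅ : ∀ G → indepPolyAtNegOne (G ⊔ C₅) ≡ indepPolyAtNegOne G
indepPolyAtNegOne-⊔-C₅ G =
  trans (indepPolyAtNegOne-⊔ G C₅) (trans (cong (indepPolyAtNegOne G ℤ.*_) indepPolyAtNegOne-C₅) (ℤ.*-identityʳ _))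

cyclomatic-⊔-C₅ : ∀ G → cyclomatic (G ⊔ C₅) ≡ cyclomatic G + + 1
cyclomatic-⊔-C₅ G = trans (cyclomatic-⊔ G C₅) (cong (_+_ (cyclomatic G)) cyclomatic-C₅)

-- Chains of triangles

-- Triangles {3t, 3t+1, 3t+2} joined in a row by the edges {3t+2, 3t+3}; each edge is listed from its smaller end.
chainEdge : ℕ → ℕ → Bool
chainEdge 0 1 = true
chainEdge 0 2 = true
chainEdge 1 2 = true
chainEdge 2 3 = true
chainEdge (suc (suc (suc x))) (suc (suc (suc y))) = chainEdge x y
chainEdge _ _ = false

chainEdge-irrefl : ∀ x → chainEdge x x ≡ false
chainEdge-irrefl 0 = refl
chainEdge-irrefl 1 = refl
chainEdge-irrefl 2 = refl
chainEdge-irrefl (suc (suc (suc x))) = chainEdge-irrefl x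

chainEdge-suc : ∀ x → chainEdge x (suc x) ≡ true
chainEdge-suc 0 = refl
chainEdge-suc 1 = refl
chainEdge-suc 2 = refl
chainEdge-suc (suc (suc (suc x))) = chainEdge-suc x

chainAdjacency : ∀ {n} → Adjacency n
chainAdjacency i j = chainEdge (toℕ i) (toℕ j) ∨ chainEdge (toℕ j) (toℕ i)

chainAdjacency-sym : ∀ {n} → IsSymmetric (chainAdjacency {n})
chainAdjacency-sym i j = Bool.∨-comm (chainEdge (toℕ i) (toℕ j)) _

chainAdjacency-irrefl : ∀ {n} → IsIrreflexive (chainAdjacency {n})
chainAdjacency-irrefl i = cong₂ _∨_ (chainEdge-irrefl (toℕ i)) (chainEdge-irrefl (toℕ i))

-- chain m has m + 1 triangles.
chain : ℕ → Graph
chain m = record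
  { n = suc m ℕ.* 3 ; adj = chainAdjacency ; sym = chainAdjacency-sym ; irrefl = chainAdjacency-irrefl }

first : ∀ {n} → Fin n → Bool
first zero    = true
first (suc _) = false

_◂_ : ∀ {n} → Bool → (Fin n → Bool) → Fin (suc n) → Bool
(b ◂ X) zero    = b
(b ◂ X) (suc i) = X i

-- T⁺ is T = chainAdjacency {N}, with A = I(T) and B = I(T − v) for its first vertex v, preceded by a triangle
-- {0, 1, 2} with 2 joined to v. Expanding at 0, 1 and 2 gives I(T⁺) = −A − B and I(T⁺ − 0) = −B.
module ChainStep {N : ℕ} (A B : ℤ)
  (I-none  : ∀ X → X ≗ none  → I[ chainAdjacency {N} ∖ X ] ≡ A)
  (I-first : ∀ X → X ≗ first → I[ chainAdjacency {N} ∖ X ] ≡ B) where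

  private
    a₀ : Adjacency (3 ℕ.+ N)
    a₀ = chainAdjacency
    a₁ : Adjacency (2 ℕ.+ N)
    a₁ = tail a₀
    a₂ : Adjacency (1 ℕ.+ N)
    a₂ = tail a₁

    s₀ : IsSymmetric a₀
    s₀ = chainAdjacency-sym
    i₀ : IsIrreflexive a₀
    i₀ = chainAdjacency-irrefl
    s₁ : IsSymmetric a₁
    s₁ = tail-sym {a = a₀} s₀
    i₁ : IsIrreflexive a₁
    i₁ = tail-irrefl {a = a₀} i₀
    s₂ : IsSymmetric a₂
    s₂ = tail-sym {a = a₁} s₁
    i₂ : IsIrreflexive a₂
    i₂ = tail-irrefl {a = a₁} i₁

    a₀-neighbours : ∀ j → a₀ zero (suc j) ≡ (true ◂ first) j
    a₀-neighbours zero          = refl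
    a₀-neighbours (suc zero)    = refl
    a₀-neighbours (suc (suc j)) = refl

    a₁-neighbours : ∀ j → a₁ zero (suc j) ≡ first j
    a₁-neighbours zero    = refl
    a₁-neighbours (suc j) = refl

    a₂-neighbours : ∀ j → a₂ zero (suc j) ≡ first j
    a₂-neighbours zero    = refl
    a₂-neighbours (suc j) = refl

    I₂-none : ∀ X → X ≗ none → I[ a₂ ∖ X ] ≡ A - B
    I₂-none X h = trans (I-recurrence-∉ a₂ s₂ i₂ X (h zero)) (cong₂ _-_ (I-none _ (h ∘ suc))
      (I-first _ (λ j → trans (cong (_∨ a₂ zero (suc j)) (h (suc j))) (a₂-neighbours j))))

    I₂-first : ∀ X → X ≗ first → I[ a₂ ∖ X ] ≡ A
    I₂-first X h = trans (I-recurrence-∈ a₂ s₂ i₂ X (h zero)) (I-none _ (h ∘ suc))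

    I₁-none : ∀ X → X ≗ none → I[ a₁ ∖ X ] ≡ (A - B) - A
    I₁-none X h = trans (I-recurrence-∉ a₁ s₁ i₁ X (h zero)) (cong₂ _-_ (I₂-none _ (h ∘ suc))
      (I₂-first _ (λ j → trans (cong (_∨ a₁ zero (suc j)) (h (suc j))) (a₁-neighbours j))))

    I₁-first₂ : ∀ X → X ≗ true ◂ first → I[ a₁ ∖ X ] ≡ A
    I₁-first₂ X h = trans (I-recurrence-∈ a₁ s₁ i₁ X (h zero)) (I₂-first _ (h ∘ suc))

  I-none⁺ : ∀ X → X ≗ none → I[ a₀ ∖ X ] ≡ ((A - B) - A) - A
  I-none⁺ X h = trans (I-recurrence-∉ a₀ s₀ i₀ X (h zero)) (cong₂ _-_ (I₁-none _ (h ∘ suc))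
    (I₁-first₂ _ (λ j → trans (cong (_∨ a₀ zero (suc j)) (h (suc j))) (a₀-neighbours j))))

  I-first⁺ : ∀ X → X ≗ first → I[ a₀ ∖ X ] ≡ (A - B) - A
  I-first⁺ X h = trans (I-recurrence-∈ a₀ s₀ i₀ X (h zero)) (I₁-none _ (h ∘ suc))

I-chain : ∀ m →
  (∀ X → X ≗ none  → I[ chainAdjacency {suc m ℕ.* 3} ∖ X ] ≡ negOnePow (suc m) ℤ.* + (2 ℕ.+ m)) ×
  (∀ X → X ≗ first → I[ chainAdjacency {suc m ℕ.* 3} ∖ X ] ≡ negOnePow (suc m))
I-chain zero    = (λ X h → I[∖]-cong chainAdjacency h) , (λ X h → I[∖]-cong chainAdjacency h)
I-chain (suc m) =
  (λ X h → trans (I-none⁺ X h) (trans (step-none (negOnePow (suc m)) (+ (2 ℕ.+ m)))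
                                      (cong (λ k → - negOnePow (suc m) ℤ.* k) (≡.sym (ℤ.pos-+ 1 (2 ℕ.+ m)))))) ,
  (λ X h → trans (I-first⁺ X h) (step-first (negOnePow (suc m)) (+ (2 ℕ.+ m))))
  where
  open ChainStep _ _ (proj₁ (I-chain m)) (proj₂ (I-chain m))
  step-none : ∀ s k → ((s ℤ.* k - s) - s ℤ.* k) - s ℤ.* k ≡ - s ℤ.* (+ 1 + k)
  step-none = solve-∀
  step-first : ∀ s k → (s ℤ.* k - s) - s ℤ.* k ≡ - s
  step-first = solve-∀

∣indepPolyAtNegOne-chain∣ : ∀ m → ∣ indepPolyAtNegOne (chain m) ∣ ≡ 2 ℕ.+ m
∣indepPolyAtNegOne-chain∣ m = begin
  ∣ indepPolyAtNegOne (chain m) ∣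
    ≡⟨ cong ∣_∣ (trans (indepPolyAtNegOne≡I (chain m)) (proj₁ (I-chain m) none (λ _ → refl))) ⟩
  ∣ negOnePow (suc m) ℤ.* + (2 ℕ.+ m) ∣              ≡⟨ ℤ.abs-* (negOnePow (suc m)) _ ⟩
  ∣ negOnePow (suc m) ∣ ℕ.* (2 ℕ.+ m)                ≡⟨ cong (ℕ._* (2 ℕ.+ m)) (∣negOnePow∣ (suc m)) ⟩
  1 ℕ.* (2 ℕ.+ m)                                    ≡⟨ ℕ.*-identityˡ (2 ℕ.+ m) ⟩
  2 ℕ.+ m ∎
  where
  ∣negOnePow∣ : ∀ k → ∣ negOnePow k ∣ ≡ 1
  ∣negOnePow∣ zero    = refl
  ∣negOnePow∣ (suc k) = trans (ℤ.∣-i∣≡∣i∣ (negOnePow k)) (∣negOnePow∣ k)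

edges-chain-step : ∀ N → edges (chainAdjacency {3 ℕ.+ suc N}) ≡ 4 ℕ.+ edges (chainAdjacency {suc N})
edges-chain-step N = cong₂ (λ x y → 2 ℕ.+ x ℕ.+ y) (countᶠ-false (suc N) (λ _ → refl))
  (cong₂ (λ x y → suc x ℕ.+ y) (countᶠ-false (suc N) (λ _ → refl))
    (cong (λ x → suc x ℕ.+ edges (chainAdjacency {suc N})) (countᶠ-false N (λ _ → refl))))

edges-chain : ∀ m → edges (chainAdjacency {suc m ℕ.* 3}) ≡ suc m ℕ.* 3 ℕ.+ m
edges-chain zero    = refl
edges-chain (suc m) = begin
  edges (chainAdjacency {3 ℕ.+ suc m ℕ.* 3})
    ≡⟨ edges-chain-step (suc (suc (m ℕ.* 3))) ⟩
  4 ℕ.+ edges (chainAdjacency {suc m ℕ.* 3})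
    ≡⟨ cong (4 ℕ.+_) (edges-chain m) ⟩
  4 ℕ.+ (suc m ℕ.* 3 ℕ.+ m)
    ≡⟨ arith m ⟩
  suc (suc m) ℕ.* 3 ℕ.+ suc m ∎
  where
  arith : ∀ m → 4 ℕ.+ (suc m ℕ.* 3 ℕ.+ m) ≡ suc (suc m) ℕ.* 3 ℕ.+ suc m
  arith = ℕ-solve-∀

components-chain : ∀ m → components (chainAdjacency {suc m ℕ.* 3}) ≡ 1
components-chain m = components-traceable {suc (suc (m ℕ.* 3))} chainAdjacency (λ w →
  trans (cong (λ x → chainEdge (suc (toℕ w)) x ∨ chainEdge x (suc (toℕ w))) (Fin.toℕ-inject₁ w))
        (trans (cong (chainEdge (suc (toℕ w)) (toℕ w) ∨_) (chainEdge-suc (toℕ w))) (Bool.∨-zeroʳ _)))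

cyclomatic-chain : ∀ m → cyclomatic (chain m) ≡ + suc m
cyclomatic-chain m = begin
  cyclomatic (chain m)
    ≡⟨ cyclomatic≡cyclomaticNumber (chain m) ⟩
  cyclomaticNumber (suc m ℕ.* 3) (edges (adj (chain m))) (components (adj (chain m)))
    ≡⟨ cong₂ (cyclomaticNumber (suc m ℕ.* 3)) (edges-chain m) (components-chain m) ⟩
  + (suc m ℕ.* 3 ℕ.+ m) - + (suc m ℕ.* 3) + + 1
    ≡⟨ cong (λ e → e - + (suc m ℕ.* 3) + + 1) (ℤ.pos-+ (suc m ℕ.* 3) m) ⟩
  (+ (suc m ℕ.* 3) + + m) - + (suc m ℕ.* 3) + + 1
    ≡⟨ cancel (+ (suc m ℕ.* 3)) (+ m) ⟩
  + 1 + + m ∎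
  where
  cancel : ∀ v x → (v + x) - v + + 1 ≡ + 1 + x
  cancel = solve-∀

∣indepPolyAtNegOne-⊔-chain∣ : ∀ G m → ∣ indepPolyAtNegOne (G ⊔ chain m) ∣ ≡ (2 ℕ.+ m) ℕ.* ∣ indepPolyAtNegOne G ∣
∣indepPolyAtNegOne-⊔-chain∣ G m = begin
  ∣ indepPolyAtNegOne (G ⊔ chain m) ∣
    ≡⟨ cong ∣_∣ (indepPolyAtNegOne-⊔ G (chain m)) ⟩
  ∣ indepPolyAtNegOne G ℤ.* indepPolyAtNegOne (chain m) ∣
    ≡⟨ ℤ.abs-* (indepPolyAtNegOne G) _ ⟩
  ∣ indepPolyAtNegOne G ∣ ℕ.* ∣ indepPolyAtNegOne (chain m) ∣
    ≡⟨ cong (∣ indepPolyAtNegOne G ∣ ℕ.*_) (∣indepPolyAtNegOne-chain∣ m) ⟩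
  ∣ indepPolyAtNegOne G ∣ ℕ.* (2 ℕ.+ m)
    ≡⟨ ℕ.*-comm ∣ indepPolyAtNegOne G ∣ (2 ℕ.+ m) ⟩
  (2 ℕ.+ m) ℕ.* ∣ indepPolyAtNegOne G ∣ ∎

cyclomatic-⊔-chain : ∀ G m → cyclomatic (G ⊔ chain m) ≡ cyclomatic G + + (2 ℕ.+ m) - + 1
cyclomatic-⊔-chain G m = begin
  cyclomatic (G ⊔ chain m)                 ≡⟨ cyclomatic-⊔ G (chain m) ⟩
  cyclomatic G + cyclomatic (chain m)      ≡⟨ cong (_+_ (cyclomatic G)) (cyclomatic-chain m) ⟩
  cyclomatic G + + suc m                   ≡⟨ shift (cyclomatic G) (+ suc m) ⟩
  cyclomatic G + (+ 1 + + suc m) - + 1     ≡⟨ cong (λ x → cyclomatic G + x - + 1) (≡.sym (ℤ.pos-+ 1 (suc m))) ⟩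
  cyclomatic G + + (2 ℕ.+ m) - + 1 ∎
  where
  shift : ∀ x y → x + y ≡ x + (+ 1 + y) - + 1
  shift = solve-∀

corollary3p4 : (G : Graph) →
    (Σ Graph λ H₁ → (indepPolyAtNegOne H₁ ≡ - indepPolyAtNegOne G) × (cyclomatic H₁ ≡ cyclomatic G))
    × (Σ Graph λ H₂ → (indepPolyAtNegOne H₂ ≡ indepPolyAtNegOne G) × (cyclomatic H₂ ≡ cyclomatic G + + 1))
    × ((k : ℕ) → 1 ≤ k → Σ Graph λ H₃ →
         (∣ indepPolyAtNegOne H₃ ∣ ≡ k Data.Nat.* ∣ indepPolyAtNegOne G ∣)
         × (cyclomatic H₃ ≡ cyclomatic G + + k - + 1))
corollary3p4 G =
    (G ⊔ K₂ , indepPolyAtNegOne-⊔-K₂ G , cyclomatic-⊔-K₂ G)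
  , (G ⊔ C₅ , indepPolyAtNegOne-⊔-C₅ G , cyclomatic-⊔-C₅ G)
  , λ where
      zero          ()
      (suc zero)    _ → G , ≡.sym (ℕ.*-identityˡ _) , x≡x+1-1 (cyclomatic G)
      (suc (suc m)) _ → G ⊔ chain m , ∣indepPolyAtNegOne-⊔-chain∣ G m , cyclomatic-⊔-chain G m
  where
  x≡x+1-1 : ∀ x → x ≡ x + + 1 - + 1
  x≡x+1-1 = solve-∀
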